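{- Let $\mathcal F\subseteq\mathcal P([n])$ be a diamond-saturated family with $\emptyset,[n]\notin\mathcal F$, let $\mathcal A$ be its set of minimal elements and $W=\{i\in[n]: i\notin X\text{ for all }X\in\mathcal A\}$. Let $a_1,\dots,a_k$, $\mathcal A_1\supsetneq\dots\supsetneq\mathcal A_k$ and $A_1,\dots,A_k$ be obtained by the construction described in the context (for any admissible choices). Then $\bigcup_{i=1}^k A_i=[n]\setminus W$.
   Context: $\mathcal P([n])$ is the power set of $[n]=\{1,\dots,n\}$ ordered by inclusion. A diamond is four distinct sets $D,P,Q,T$ with $D\subsetneq P\subsetneq T$, $D\subsetneq Q\subsetneq T$, $P,Q$ incomparable; $\mathcal F$ is diamond-saturated if it contains no diamond but $\mathcal F\cup\{S\}$ contains one for every $S\in\mathcal P([n])\setminus\mathcal F$. For a family $\mathcal G\subseteq\mathcal P([n])$ and $i\in[n]$ let $f(i,\mathcal G)=\{G\in\mathcal G:i\in G\}$ and $W(\mathcal G)=\{i\in[n]:f(i,\mathcal G)=\emptyset\}$. Construction: set $\mathcal A_1=\mathcal A$. For $i\geq1$, if $\mathcal A_i\neq\emptyset$ choose $a_i\in[n]\setminus W(\mathcal A_i)$ such that $f(a_i,\mathcal A_i)$ is an inclusion-minimal element of $\{f(j,\mathcal A_i):j\in[n]\setminus W(\mathcal A_i)\}$, and set $\mathcal A_{i+1}=\mathcal A_i\setminus f(a_i,\mathcal A_i)$; let $k$ be the last index with $\mathcal A_k\neq\emptyset$ (so $\mathcal A_{k+1}=\emptyset$). For $1\leq i\leq k$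 let $A_i=\{j\in[n]:f(j,\mathcal A_i)=f(a_i,\mathcal A_i)\}$. -}

module Defs where

open import Data.Nat using (ℕ; suc; _≤_)
open import Data.Fin using (Fin)
open import Data.Bool using (Bool; true; false; _∧_; not)
open import Data.Vec using (lookup)
open import Data.Fin.Subset using (Subset; _∈_; _∉_; _⊆_; _⊂_)
open import Data.Product using (_×_; ∃; ∃-syntax; Σ-syntax)
open import Data.Sum using (_⊎_)
open import Relation.Nullary using (¬_)
open import Relation.Binary.PropositionalEquality using (_≡_)

Fam : ℕ → Set
Fam n = Subset n → Bool

module _ {n : ℕ} where

  infix 4 _∈𝓕_ _⊆𝓕_ _≐_

  _∈𝓕_ : Subset n → Fam n → Set
  X ∈𝓕 G = G X ≡ true

  _⊆𝓕_ : Fam n → Fam n → Set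
  G ⊆𝓕 H = ∀ X → X ∈𝓕 G → X ∈𝓕 H

  _≐_ : Fam n → Fam n → Set
  G ≐ H = (G ⊆𝓕 H) × (H ⊆𝓕 G)

  _∖𝓕_ : Fam n → Fam n → Fam n
  (G ∖𝓕 H) X = G X ∧ not (H X)

  Empty : Fam n → Set
  Empty G = ∀ X → ¬ (X ∈𝓕 G)

  NonEmpty : Fam n → Set
  NonEmpty G = ∃[ X ] (X ∈𝓕 G)

  f : Fin n → Fam n → Fam n
  f i G X = G X ∧ lookup X i

  W : Fam n → Fin n → Set
  W G i = Empty (f i G)

  HasDiamond : (Subset n → Set) → Set
  HasDiamond 𝒫 = ∃[ D ] ∃[ P ] ∃[ Q ] ∃[ T ]
    (𝒫 D × 𝒫 P × 𝒫 Q × 𝒫 T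
     × D ⊂ P × P ⊂ T × D ⊂ Q × Q ⊂ T
     × ¬ (P ⊆ Q) × ¬ (Q ⊆ P))

  DiamondSaturated : Fam n → Set
  DiamondSaturated F =
    ¬ HasDiamond (λ X → X ∈𝓕 F)
    × (∀ S → ¬ (S ∈𝓕 F) → HasDiamond (λ X → X ∈𝓕 F ⊎ X ≡ S))

  IsMinimal : Fam n → Subset n → Set
  IsMinimal F X = X ∈𝓕 F × (∀ Y → Y ∈𝓕 F → Y ⊆ X → Y ≡ X)

  WMin : Fam n → Fin n → Set
  WMin F i = ∀ X → IsMinimal F X → i ∉ X

  Admissible : Fam n → Fin n → Set
  Admissible G a =
    ¬ W G a × (∀ j → ¬ W G j → f j G ⊆𝓕 f a G → f a G ⊆𝓕 f j G)

  -- The construction (1-indexed): 𝒜 1 = minimal elements of F;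
  -- for 1 ≤ i ≤ k, 𝒜 i ≠ ∅, a i admissible, 𝒜 (i+1) = 𝒜 i ∖ f(a i, 𝒜 i);
  -- and 𝒜 (k+1) = ∅  (so k is the last index with 𝒜 k ≠ ∅).
  IsConstruction : Fam n → (ℕ → Fam n) → (ℕ → Fin n) → ℕ → Set
  IsConstruction F 𝒜 a k =
    (∀ X → (X ∈𝓕 𝒜 1 → IsMinimal F X) × (IsMinimal F X → X ∈𝓕 𝒜 1))
    × (∀ i → 1 ≤ i → i ≤ k →
         NonEmpty (𝒜 i) × Admissible (𝒜 i) (a i)
         × (𝒜 (suc i) ≐ (𝒜 i ∖𝓕 f (a i) (𝒜 i))))
    × Empty (𝒜 (suc k))

  Ablock : (ℕ → Fam n) → (ℕ → Fin n) → ℕ → Fin n → Set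
  Ablock 𝒜 a i j = f j (𝒜 i) ≐ f (a i) (𝒜 i)

{-# OPTIONS --safe #-}
-- Every 𝒜ᵢ consists of minimal elements of F, and a block Aᵢ is cut out by the
-- nonempty f(aᵢ,𝒜ᵢ), so its elements lie in minimal sets.  Conversely, if j lies in
-- a minimal set then j ∉ W(𝒜₁) while j ∈ W(𝒜ₖ₊₁) = [n]; at the last i with
-- j ∉ W(𝒜ᵢ), every set of 𝒜ᵢ containing j contains aᵢ, i.e. f(j,𝒜ᵢ) ⊆ f(aᵢ,𝒜ᵢ),
-- and the minimality of the choice of aᵢ makes this an equality: j ∈ Aᵢ.
module Submission where

open import Defs
open import Data.Nat using (ℕ; zero; suc; _≤_; _<_; z≤n; s≤s)
open import Data.Nat.Properties using (≤-refl; <⇒≤; m≤n⇒m<n∨m≡n; m≤n⇒m≤1+n)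
open import Data.Fin using (Fin)
open import Data.Fin.Subset using (_∈_; ⊥; ⊤)
open import Data.Fin.Subset.Properties using (_∈?_; anySubset?)
open import Data.Bool using (true; false)
open import Data.Bool.Properties using (_≟_; ∧-conicalˡ; ∧-conicalʳ)
open import Data.Vec.Properties using (lookup⇒[]=; []=⇒lookup)
open import Data.Product using (_×_; _,_; proj₁; proj₂; ∃-syntax)
open import Data.Sum using (inj₁; inj₂)
open import Function using (_∘_)
open import Relation.Nullary using (¬_; Dec; yes; no; ¬?)
open import Relation.Nullary.Decidable using (map′)
open import Relation.Nullary.Negation using (contradiction; ¬∃⟶∀¬; ∀¬⟶¬∃)
open import Relation.Unary using (Decidable)
open import Relation.Binary.PropositionalEquality using (refl)

last-crossing : ∀ {P : ℕ → Set} → Decidable P → ∀ {m n} → m ≤ n → ¬ P m → P n →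
                ∃[ i ] (m ≤ i × i < n × ¬ P i × P (suc i))
last-crossing P? {n = zero} z≤n ¬Pm Pn = contradiction Pn ¬Pm
last-crossing P? {m} {suc n} m≤1+n ¬Pm P1+n with m≤n⇒m<n∨m≡n m≤1+n
... | inj₂ refl = contradiction P1+n ¬Pm
... | inj₁ (s≤s m≤n) with P? n
...   | no ¬Pn = n , m≤n , ≤-refl , ¬Pn , P1+n
...   | yes Pn with last-crossing P? m≤n ¬Pm Pn
...     | i , m≤i , i<n , ¬Pi , P1+i = i , m≤i , m≤n⇒m≤1+n i<n , ¬Pi , P1+i

module _ {n : ℕ} where

  f-⊆ : ∀ i (G : Fam n) → f i G ⊆𝓕 G
  f-⊆ i G X = ∧-conicalˡ (G X) _

  ∈𝓕-f⇒∈ : ∀ (G : Fam n) {X i} → X ∈𝓕 f i G → i ∈ X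
  ∈𝓕-f⇒∈ G {X} {i} = lookup⇒[]= i X ∘ ∧-conicalʳ (G X) _

  ∈𝓕-f⁺ : ∀ (G : Fam n) {X i} → X ∈𝓕 G → i ∈ X → X ∈𝓕 f i G
  ∈𝓕-f⁺ G X∈G i∈X rewrite X∈G = []=⇒lookup i∈X

  ∖𝓕-⊆ : ∀ (G H : Fam n) → G ∖𝓕 H ⊆𝓕 G
  ∖𝓕-⊆ G H X = ∧-conicalˡ (G X) _

  ∈𝓕-∖⁺ : ∀ (G H : Fam n) {X} → X ∈𝓕 G → ¬ X ∈𝓕 H → X ∈𝓕 G ∖𝓕 H
  ∈𝓕-∖⁺ G H {X} X∈G X∉H with H X
  ... | true  = contradiction refl X∉H
  ... | false rewrite X∈G = refl

  f-mono : ∀ {G H : Fam n} i → G ⊆𝓕 H → f i G ⊆𝓕 f i H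
  f-mono {G} {H} i G⊆H X X∈fG =
    ∈𝓕-f⁺ H (G⊆H X (f-⊆ i G X X∈fG)) (∈𝓕-f⇒∈ G X∈fG)

  Empty-anti : ∀ {G H : Fam n} → G ⊆𝓕 H → Empty H → Empty G
  Empty-anti G⊆H emptyH X X∈G = emptyH X (G⊆H X X∈G)

  Empty? : (G : Fam n) → Dec (Empty G)
  Empty? G = map′ ¬∃⟶∀¬ ∀¬⟶¬∃ (¬? (anySubset? (λ X → G X ≟ true)))

  W? : (G : Fam n) (i : Fin n) → Dec (W G i)
  W? G i = Empty? (f i G)

  W-anti : ∀ {G H : Fam n} {i} → G ⊆𝓕 H → W H i → W G i
  W-anti {i = i} G⊆H = Empty-anti (f-mono i G⊆H)

  W-∖f⇒f⊆f : ∀ {G : Fam n} {a j} → W (G ∖𝓕 f a G) j → f j G ⊆𝓕 f a G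
  W-∖f⇒f⊆f {G} {a} {j} W[G∖faG]j X X∈fjG = by-cases (a ∈? X)
    where
    X∈G : X ∈𝓕 G
    X∈G = f-⊆ j G X X∈fjG
    by-cases : Dec (a ∈ X) → X ∈𝓕 f a G
    by-cases (yes a∈X) = ∈𝓕-f⁺ G X∈G a∈X
    by-cases (no  a∉X) = contradiction X∈f[G∖faG] (W[G∖faG]j X)
      where
      X∈f[G∖faG] : X ∈𝓕 f j (G ∖𝓕 f a G)
      X∈f[G∖faG] = ∈𝓕-f⁺ (G ∖𝓕 f a G) (∈𝓕-∖⁺ G (f a G) X∈G (a∉X ∘ ∈𝓕-f⇒∈ G)) (∈𝓕-f⇒∈ G X∈fjG)

  Admissible-block : ∀ {G : Fam n} {a j} → Admissible G a →
                     ¬ W G j → W (G ∖𝓕 f a G) j → f j G ≐ f a G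
  Admissible-block (_ , minimal) ¬Wj W[G∖faG]j =
    let fj⊆fa = W-∖f⇒f⊆f W[G∖faG]j in fj⊆fa , minimal _ ¬Wj fj⊆fa

  WMin⇒W : ∀ {F G : Fam n} {j} → (∀ X → X ∈𝓕 G → IsMinimal F X) → WMin F j → W G j
  WMin⇒W {G = G} {j} G-minimal WMinj X X∈fjG =
    WMinj X (G-minimal X (f-⊆ j G X X∈fjG)) (∈𝓕-f⇒∈ G X∈fjG)

  W⇒WMin : ∀ {F G : Fam n} {j} → (∀ X → IsMinimal F X → X ∈𝓕 G) → W G j → WMin F j
  W⇒WMin {G = G} minimal-G Wj X X-minimal j∈X =
    Wj X (∈𝓕-f⁺ G (minimal-G X X-minimal) j∈X)

module Construction {n : ℕ} {F : Fam n} {𝒜 : ℕ → Fam n} {a : ℕ → Fin n} {k : ℕ}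
                    (C : IsConstruction F 𝒜 a k) where

  private
    step : ∀ {i} → 1 ≤ i → i ≤ k →
           NonEmpty (𝒜 i) × Admissible (𝒜 i) (a i) × (𝒜 (suc i) ≐ (𝒜 i ∖𝓕 f (a i) (𝒜 i)))
    step = proj₁ (proj₂ C) _

  admissible : ∀ {i} → 1 ≤ i → i ≤ k → Admissible (𝒜 i) (a i)
  admissible 1≤i i≤k = proj₁ (proj₂ (step 1≤i i≤k))

  𝒜-next : ∀ {i} → 1 ≤ i → i ≤ k → 𝒜 (suc i) ≐ 𝒜 i ∖𝓕 f (a i) (𝒜 i)
  𝒜-next 1≤i i≤k = proj₂ (proj₂ (step 1≤i i≤k))

  𝒜-minimal : ∀ {i} → i ≤ k → ∀ X → X ∈𝓕 𝒜 (suc i) → IsMinimal F X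
  𝒜-minimal {zero}  _   X X∈𝒜₁ = proj₁ (proj₁ C X) X∈𝒜₁
  𝒜-minimal {suc i} i<k X X∈𝒜 =
    𝒜-minimal (<⇒≤ i<k) X
      (∖𝓕-⊆ (𝒜 (suc i)) (f (a (suc i)) (𝒜 (suc i))) X (proj₁ (𝒜-next (s≤s z≤n) i<k) X X∈𝒜))

  Ablock⇒¬WMin : ∀ {j} → ∃[ i ] (1 ≤ i × i ≤ k × Ablock 𝒜 a i j) → ¬ WMin F j
  Ablock⇒¬WMin (suc i , 1≤i , i<k , _ , fa⊆fj) WMinj =
    proj₁ (admissible 1≤i i<k) (Empty-anti fa⊆fj (WMin⇒W (𝒜-minimal (<⇒≤ i<k)) WMinj))

  ¬WMin⇒¬W𝒜₁ : ∀ {j} → ¬ WMin F j → ¬ W (𝒜 1) j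
  ¬WMin⇒¬W𝒜₁ ¬WMinj = ¬WMinj ∘ W⇒WMin (λ X → proj₂ (proj₁ C X))

  W𝒜ₖ₊₁ : ∀ j → W (𝒜 (suc k)) j
  W𝒜ₖ₊₁ j = Empty-anti (f-⊆ j (𝒜 (suc k))) (proj₂ (proj₂ C))

  ¬WMin⇒Ablock : ∀ {j} → ¬ WMin F j → ∃[ i ] (1 ≤ i × i ≤ k × Ablock 𝒜 a i j)
  ¬WMin⇒Ablock {j} ¬WMinj
    with last-crossing (λ i → W? (𝒜 i) j) (s≤s z≤n) (¬WMin⇒¬W𝒜₁ ¬WMinj) (W𝒜ₖ₊₁ j)
  ... | i , 1≤i , s≤s i≤k , ¬Wi , W1+i =
    i , 1≤i , i≤k ,
    Admissible-block (admissible 1≤i i≤k) ¬Wi (W-anti (proj₂ (𝒜-next 1≤i i≤k)) W1+i)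

lemma3p1 : (n : ℕ) (F : Fam n) → DiamondSaturated F
    → ¬ (⊥ ∈𝓕 F) → ¬ (⊤ ∈𝓕 F)
    → (𝒜 : ℕ → Fam n) (a : ℕ → Fin n) (k : ℕ) → IsConstruction F 𝒜 a k
    → ∀ j → ((∃[ i ] (1 ≤ i × i ≤ k × Ablock 𝒜 a i j)) → ¬ WMin F j)
            × (¬ WMin F j → ∃[ i ] (1 ≤ i × i ≤ k × Ablock 𝒜 a i j))
lemma3p1 _ _ _ _ _ _ _ _ C _ = Ablock⇒¬WMin , ¬WMin⇒Ablock
  where open Construction C
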